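{- Let $L=E[C_1,\dots,C_n]$ be a congruence uniform lattice obtained from the one-element lattice by successively doubling nonempty intervals $C_1,\dots,C_n$. Then $L$ is left modular if and only if, for every $i$, $C_i$ contains an element of the spine of $E[C_1,\dots,C_{i-1}]$.
   Context: All lattices are finite. For a convex subset $C$ of $L$, $I_L(C)=\{y\mid\exists x\in C,y\le x\}$ and the doubling $L[C]$ is the subposet of $L\times\{0<1\}$ on $(I_L(C)\times\{0\})\sqcup\big(((L\setminus I_L(C))\cup C)\times\{1\}\big)$. $E[\,]$ is the one-element lattice and $E[C_1,\dots,C_{i+1}]=E[C_1,\dots,C_i][C_{i+1}]$. The spine of a lattice is the set of elements lying on some chain of maximum length. An element $a$ is left modular if for all $b<c$, $(b\vee a)\wedge c=b\vee(a\wedge c)$; a lattice is left modular if it has a maximal chain consisting of left modular elements. -}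

module Defs where

open import Data.Bool.Base using (Bool; true; false)
import Data.Bool.Base as B
open import Data.Nat.Base using (ℕ; zero; suc; _≤_)
open import Data.Vec.Base using (Vec; []; _∷_)
open import Data.Vec.Relation.Binary.Pointwise.Inductive using (Pointwise)
open import Data.List.Base using (List; length)
open import Data.List.Relation.Unary.All using (All)
open import Data.List.Membership.Propositional using (_∈_)
open import Data.List.Relation.Unary.Unique.Propositional using (Unique)
open import Data.Product using (_×_; ∃; ∃-syntax)
open import Data.Sum using (_⊎_)
open import Data.Unit using (⊤)
open import Relation.Nullary using (¬_)
open import Relation.Binary.PropositionalEquality using (_≡_; _≢_)

-- Concrete model.  E[C₁,…,Cₙ] ⊆ E × 2 × … × 2, so its elements are
-- bit-vectors of length n (the newest doubling coordinate is the head),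
-- ordered componentwise (the product order, restricted).

_≼_ : ∀ {n} → Vec Bool n → Vec Bool n → Set
_≼_ = Pointwise B._≤_

_≺_ : ∀ {n} → Vec Bool n → Vec Bool n → Set
x ≺ y = x ≼ y × x ≢ y

-- A sequence of doublings: the (i+1)-st set is a subset (predicate) of
-- the ambient 2^i containing E[C₁,…,Cᵢ].
data Doublings : ℕ → Set₁ where
  []  : Doublings zero
  _▷_ : ∀ {n} → Doublings n → (Vec Bool n → Set) → Doublings (suc n)

Elem : ∀ {n} → Doublings n → Vec Bool n → Set
-- I_L(C) = down-set generated by C  (C ⊆ L is part of validity)
Down : ∀ {n} → (Vec Bool n → Set) → Vec Bool n → Set
Down C x = ∃[ y ] (C y × x ≼ y)

Elem []      []          = ⊤
Elem (D ▷ C) (false ∷ x) = Elem D x × Down C x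
Elem (D ▷ C) (true ∷ x)  = Elem D x × (¬ Down C x ⊎ C x)

IsNonemptyInterval : ∀ {n} → Doublings n → (Vec Bool n → Set) → Set
IsNonemptyInterval D C =
  ∃[ a ] ∃[ b ] (Elem D a × Elem D b × a ≼ b ×
    (∀ x → (C x → Elem D x × a ≼ x × x ≼ b)
         × (Elem D x × a ≼ x × x ≼ b → C x)))

ValidDoublings : ∀ {n} → Doublings n → Set
ValidDoublings []      = ⊤
ValidDoublings (D ▷ C) = ValidDoublings D × IsNonemptyInterval D C

module _ {n} (D : Doublings n) where

  IsJoin : Vec Bool n → Vec Bool n → Vec Bool n → Set
  IsJoin x y j = Elem D j × x ≼ j × y ≼ j
               × (∀ z → Elem D z → x ≼ z → y ≼ z → j ≼ z)

  IsMeet : Vec Bool n → Vec Bool n → Vec Bool n → Set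
  IsMeet x y m = Elem D m × m ≼ x × m ≼ y
               × (∀ z → Elem D z → z ≼ x → z ≼ y → z ≼ m)

  LeftModularElem : Vec Bool n → Set
  LeftModularElem a = ∀ b c → Elem D b → Elem D c → b ≺ c →
    ∀ j m m' j' → IsJoin b a j → IsMeet j c m →
                  IsMeet a c m' → IsJoin b m' j' → m ≡ j'

  IsChain : List (Vec Bool n) → Set
  IsChain cs = All (Elem D) cs × (∀ {x y} → x ∈ cs → y ∈ cs → x ≼ y ⊎ y ≼ x)

  IsMaximalChain : List (Vec Bool n) → Set
  IsMaximalChain cs = IsChain cs ×
    (∀ z → Elem D z → (∀ {x} → x ∈ cs → z ≼ x ⊎ x ≼ z) → z ∈ cs)

  IsLeftModularLattice : Set
  IsLeftModularLattice =
    ∃[ cs ] (IsMaximalChain cs × All LeftModularElem cs)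

  -- chains of maximum length (length = number of distinct elements)
  IsMaximumLengthChain : List (Vec Bool n) → Set
  IsMaximumLengthChain cs = IsChain cs × Unique cs ×
    (∀ ds → IsChain ds → Unique ds → length ds ≤ length cs)

  InSpine : Vec Bool n → Set
  InSpine x = ∃[ cs ] (IsMaximumLengthChain cs × x ∈ cs)

AllMeetSpine : ∀ {n} → Doublings n → Set
AllMeetSpine []      = ⊤
AllMeetSpine (D ▷ C) = AllMeetSpine D × ∃[ x ] (C x × InSpine D x)

{-# OPTIONS --safe #-}
-- Elements of E[C₁,…,Cₙ] are bit vectors and their number of 1s is a rank: distinct comparable
-- elements have distinct ranks 0,…,n, so a chain has at most n + 1 elements, with equality exactly
-- when it meets every rank, and the spine is the set of elements of chains meeting every rank.
-- Both directions go by induction on the last doubling C = [a,b]; dropping the new coordinate is a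
-- lattice homomorphism onto the previous lattice.
-- (⇒) The tails of a maximal chain of left modular elements form such a chain again.  Left
-- modularity of true ∷ y, tested on false ∷ a ≺ true ∷ a, forces a ≼ y, which makes the chain
-- cross the doubled interval vertically, through false ∷ u ≺ true ∷ u with u ∈ C; by induction
-- the tails meet every rank, so u is on the spine.
-- (⇐) A maximum-length chain through a spine element s ∈ C lifts, splitting at s, to a chain
-- meeting every rank, and every element of such a chain is left modular: its tail is by induction,
-- and the head bits of (p ⊔ w) ⊓ q and p ⊔ (w ⊓ q) agree because the vertical pair of the chain
-- forces w = false ∷ x with x ≼ b or w = true ∷ y with a ≼ y.

module Submission where

open import Defs
open import Function.Base using (_∘_)
open import Function.Bundles using (_⇔_; mk⇔)
open import Function.Definitions using (Injective)
open import Data.Bool.Base as B using (Bool; true; false; not; _∨_; _∧_; b≤b; f≤t)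
import Data.Bool.Properties as BP
open import Data.Nat.Base using (ℕ; zero; suc; z≤n; s≤s; _≤_)
open import Data.Nat.Properties as NP using (≤-refl; ≤-trans; ≤-reflexive; m≤n⇒m≤1+n; suc-injective)
open import Data.Fin.Base as Fin using (Fin; toℕ; fromℕ<; punchOut)
open Fin.Fin
open import Data.Fin.Properties as FinP
  using (injective⇒≤; punchOut-injective; toℕ-injective; toℕ-fromℕ<; toℕ≤pred[n])
open import Data.Vec.Base using (Vec; []; _∷_; head; tail)
open import Data.Vec.Properties using (≡-dec)
import Data.Vec.Relation.Binary.Pointwise.Inductive as Pointwise
open Pointwise using ([]; _∷_) renaming (tail to ≼-tail)
open import Data.List.Base using (List; []; _∷_; map; length; lookup; tabulate)
open import Data.List.Properties using (length-tabulate)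
open import Data.List.Relation.Unary.All as All using (All; []; _∷_)
import Data.List.Relation.Unary.All.Properties as AllP
open import Data.List.Relation.Unary.Any using (here; there; any?)
open import Data.List.Membership.Propositional using (_∈_; find; lose)
open import Data.List.Membership.Propositional.Properties
  using (∈-lookup; ∈-map⁺; ∈-map⁻; ∈-tabulate⁺; ∈-tabulate⁻)
open import Data.List.Relation.Unary.Unique.Propositional using (Unique; []; _∷_)
open import Data.List.Relation.Unary.Unique.Propositional.Properties using (tabulate⁺)
open import Data.Product using (_×_; _,_; proj₁; proj₂; ∃-syntax)
open import Data.Sum using (_⊎_; inj₁; inj₂; swap) renaming (map to ⊎-map)
open import Data.Unit using (tt)
open import Relation.Nullary using (¬_; Dec; yes; no; does; contradiction)
open import Relation.Nullary.Decidable using (dec-true; dec-false; _×-dec_)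
open import Relation.Unary using (Decidable)
open import Relation.Binary.PropositionalEquality
  using (_≡_; _≢_; refl; sym; trans; cong; cong₂; subst; module ≡-Reasoning)

-- Finite lists: injections into Fin and least elements

module _ {A : Set} where

  InjectiveOn : ∀ {m} → (A → Fin m) → List A → Set
  InjectiveOn f xs = ∀ {x y} → x ∈ xs → y ∈ xs → f x ≡ f y → x ≡ y

  lookup-injective : ∀ {xs : List A} → Unique xs → Injective _≡_ _≡_ (lookup xs)
  lookup-injective (_   ∷ _) {zero}  {zero}  _ = refl
  lookup-injective (x≢ ∷ _) {zero}  {suc j} e = contradiction e (All.lookup x≢ (∈-lookup j))
  lookup-injective (x≢ ∷ _) {suc i} {zero}  e = contradiction (sym e) (All.lookup x≢ (∈-lookup i))
  lookup-injective (_   ∷ u) {suc i} {suc j} e = cong suc (lookup-injective u e)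

  injectiveOn⇒lookup-injective : ∀ {m} {f : A → Fin m} {xs} → Unique xs → InjectiveOn f xs →
    Injective _≡_ _≡_ (f ∘ lookup xs)
  injectiveOn⇒lookup-injective u inj e = lookup-injective u (inj (∈-lookup _) (∈-lookup _) e)

  injectiveOn⇒length≤ : ∀ {m} {f : A → Fin m} {xs} → Unique xs → InjectiveOn f xs → length xs ≤ m
  injectiveOn⇒length≤ u inj = injective⇒≤ (injectiveOn⇒lookup-injective u inj)

  -- If f missed k, punching k out would inject xs into Fin (m - 1).
  injectiveOn∧length≥⇒surjectiveOn : ∀ {m} {f : A → Fin m} {xs} → Unique xs → InjectiveOn f xs →
    m ≤ length xs → ∀ k → ∃[ x ] (x ∈ xs × f x ≡ k)
  injectiveOn∧length≥⇒surjectiveOn {suc m} {f} {xs} u inj m≤len k with any? (λ x → f x FinP.≟ k) xs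
  ... | yes hit  = find hit
  ... | no  miss = contradiction (injective⇒≤ punched-injective) (NP.<⇒≱ m≤len)
    where
    k≢f : ∀ i → k ≢ f (lookup xs i)
    k≢f i e = miss (lose (∈-lookup i) (sym e))
    punched-injective : Injective _≡_ _≡_ (λ i → punchOut (k≢f i))
    punched-injective e = injectiveOn⇒lookup-injective u inj (punchOut-injective (k≢f _) (k≢f _) e)

module _ {A : Set} {_≤_ : A → A → Set} (≤-refl : ∀ {x} → x ≤ x)
  (≤-trans : ∀ {x y z} → x ≤ y → y ≤ z → x ≤ z) {P : A → Set} (P? : Decidable P) where

  least-satisfying : ∀ xs → (∀ {x y} → x ∈ xs → y ∈ xs → x ≤ y ⊎ y ≤ x) →
    All (¬_ ∘ P) xs ⊎ ∃[ x ] (x ∈ xs × P x × ∀ {y} → y ∈ xs → P y → x ≤ y)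
  least-satisfying []       _   = inj₁ []
  least-satisfying (x ∷ xs) cmp with least-satisfying xs (λ p q → cmp (there p) (there q)) | P? x
  ... | inj₁ none | no ¬px = inj₁ (¬px ∷ none)
  ... | inj₁ none | yes px = inj₂ (x , here refl , px , λ
    { (here refl) _ → ≤-refl ; (there y∈) py → contradiction py (All.lookup none y∈) })
  ... | inj₂ (m , m∈ , pm , m≤) | no ¬px = inj₂ (m , there m∈ , pm , λ
    { (here refl) py → contradiction py ¬px ; (there y∈) → m≤ y∈ })
  ... | inj₂ (m , m∈ , pm , m≤) | yes px with cmp (here refl) (there m∈)
  ...   | inj₁ x≤m = inj₂ (x , here refl , px , λ
    { (here refl) _ → ≤-refl ; (there y∈) py → ≤-trans x≤m (m≤ y∈ py) })
  ...   | inj₂ m≤x = inj₂ (m , there m∈ , pm , λ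
    { (here refl) _ → m≤x ; (there y∈) → m≤ y∈ })

-- Bit vectors, rank, and chains meeting every rank

≼-refl : ∀ {n} {x : Vec Bool n} → x ≼ x
≼-refl = Pointwise.refl BP.≤-refl

≼-trans : ∀ {n} {x y z : Vec Bool n} → x ≼ y → y ≼ z → x ≼ z
≼-trans = Pointwise.trans BP.≤-trans

≼-antisym : ∀ {n} {x y : Vec Bool n} → x ≼ y → y ≼ x → x ≡ y
≼-antisym []       []       = refl
≼-antisym (p ∷ ps) (q ∷ qs) = cong₂ _∷_ (BP.≤-antisym p q) (≼-antisym ps qs)

_≼?_ : ∀ {n} (x y : Vec Bool n) → Dec (x ≼ y)
_≼?_ = Pointwise.decidable BP._≤?_

Comparable : ∀ {n} → Vec Bool n → Vec Bool n → Set
Comparable x y = x ≼ y ⊎ y ≼ x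

PairwiseComparable : ∀ {n} → List (Vec Bool n) → Set
PairwiseComparable cs = ∀ {x y} → x ∈ cs → y ∈ cs → Comparable x y

comparable-tail : ∀ {n} {i k} {x y : Vec Bool n} → Comparable (i ∷ x) (k ∷ y) → Comparable x y
comparable-tail (inj₁ (_ ∷ x≼y)) = inj₁ x≼y
comparable-tail (inj₂ (_ ∷ y≼x)) = inj₂ y≼x

∷-comparable : ∀ {n} {i} {x y : Vec Bool n} → Comparable x y → Comparable (i ∷ x) (i ∷ y)
∷-comparable = ⊎-map (b≤b ∷_) (b≤b ∷_)

rank : ∀ {n} → Vec Bool n → ℕ
rank []          = 0
rank (false ∷ x) = rank x
rank (true ∷ x)  = suc (rank x)

rank≤length : ∀ {n} (x : Vec Bool n) → rank x ≤ n
rank≤length []          = z≤n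
rank≤length (false ∷ x) = m≤n⇒m≤1+n (rank≤length x)
rank≤length (true ∷ x)  = s≤s (rank≤length x)

rank-mono : ∀ {n} {x y : Vec Bool n} → x ≼ y → rank x ≤ rank y
rank-mono []                  = z≤n
rank-mono (f≤t ∷ x≼y)         = m≤n⇒m≤1+n (rank-mono x≼y)
rank-mono (b≤b {false} ∷ x≼y) = rank-mono x≼y
rank-mono (b≤b {true}  ∷ x≼y) = s≤s (rank-mono x≼y)

≼∧rank≤⇒≡ : ∀ {n} {x y : Vec Bool n} → x ≼ y → rank y ≤ rank x → x ≡ y
≼∧rank≤⇒≡ []                  _           = refl
≼∧rank≤⇒≡ (f≤t ∷ x≼y)         ry≤rx       = contradiction ry≤rx (NP.<⇒≱ (s≤s (rank-mono x≼y)))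
≼∧rank≤⇒≡ (b≤b {false} ∷ x≼y) ry≤rx       = cong (false ∷_) (≼∧rank≤⇒≡ x≼y ry≤rx)
≼∧rank≤⇒≡ (b≤b {true}  ∷ x≼y) (s≤s ry≤rx) = cong (true ∷_) (≼∧rank≤⇒≡ x≼y ry≤rx)

comparable∧rank≡⇒≡ : ∀ {n} {x y : Vec Bool n} → Comparable x y → rank x ≡ rank y → x ≡ y
comparable∧rank≡⇒≡ (inj₁ x≼y) rx≡ry = ≼∧rank≤⇒≡ x≼y (≤-reflexive (sym rx≡ry))
comparable∧rank≡⇒≡ (inj₂ y≼x) rx≡ry = sym (≼∧rank≤⇒≡ y≼x (≤-reflexive rx≡ry))

rankFin : ∀ {n} → Vec Bool n → Fin (suc n)
rankFin x = fromℕ< (s≤s (rank≤length x))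

toℕ-rankFin : ∀ {n} (x : Vec Bool n) → toℕ (rankFin x) ≡ rank x
toℕ-rankFin x = toℕ-fromℕ< (s≤s (rank≤length x))

rankFin-injectiveOn : ∀ {n} {cs : List (Vec Bool n)} → PairwiseComparable cs → InjectiveOn rankFin cs
rankFin-injectiveOn cmp {x} {y} x∈ y∈ e =
  comparable∧rank≡⇒≡ (cmp x∈ y∈) (trans (sym (toℕ-rankFin x)) (trans (cong toℕ e) (toℕ-rankFin y)))

MeetsEveryRank : ∀ {n} → List (Vec Bool n) → Set
MeetsEveryRank {n} cs = ∀ k → k ≤ n → ∃[ x ] (x ∈ cs × rank x ≡ k)

VerticalPair : ∀ {n} → List (Vec Bool (suc n)) → Set
VerticalPair cs = ∃[ u ] ((false ∷ u) ∈ cs × (true ∷ u) ∈ cs)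

lower≼upper : ∀ {n} {cs : List (Vec Bool (suc n))} → PairwiseComparable cs →
  ∀ {x y} → (false ∷ x) ∈ cs → (true ∷ y) ∈ cs → x ≼ y
lower≼upper cmp x∈ y∈ with cmp x∈ y∈
... | inj₁ (_ ∷ x≼y) = x≼y
... | inj₂ (() ∷ _)

meetsEveryRank-⊆ : ∀ {n} {xs ys : List (Vec Bool n)} → (∀ {x} → x ∈ xs → x ∈ ys) →
  MeetsEveryRank xs → MeetsEveryRank ys
meetsEveryRank-⊆ xs⊆ys every k k≤n with every k k≤n
... | x , x∈ , rx = x , xs⊆ys x∈ , rx

module _ {n} {cs : List (Vec Bool (suc n))} (cmp : PairwiseComparable cs) (every : MeetsEveryRank cs)
  where

  meetsEveryRank-tails : MeetsEveryRank (map tail cs)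
  meetsEveryRank-tails k k≤n with every (suc k) (s≤s k≤n)
  ... | true ∷ x , x∈ , rx = x , ∈-map⁺ tail x∈ , suc-injective rx
  ... | false ∷ x , x∈ , rx with every k (m≤n⇒m≤1+n k≤n)
  ...   | false ∷ y , y∈ , ry = y , ∈-map⁺ tail y∈ , ry
  ...   | true ∷ y , y∈ , ry = contradiction (subst (_≤ rank y) rx (rank-mono (lower≼upper cmp x∈ y∈)))
                                           (NP.<⇒≱ (m≤n⇒m≤1+n (≤-reflexive ry)))

  -- Climb the ranks along the lower copy; the first rank met only by the upper copy gives the pair.
  private
    climb : ∀ k → k ≤ suc n → VerticalPair cs ⊎ ∃[ x ] ((false ∷ x) ∈ cs × rank x ≡ k)
    climb zero _ with every 0 z≤n
    ... | false ∷ x , x∈ , rx = inj₂ (x , x∈ , rx)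
    climb (suc k) k<n with climb k (NP.<⇒≤ k<n)
    ... | inj₁ pair = inj₁ pair
    ... | inj₂ (x , x∈ , rx) with every (suc k) k<n
    ...   | false ∷ y , y∈ , ry = inj₂ (y , y∈ , ry)
    ...   | true ∷ y , y∈ , ry = inj₁ (x , x∈ , subst (λ z → (true ∷ z) ∈ cs) (sym x≡y) y∈)
      where
      x≡y = ≼∧rank≤⇒≡ (lower≼upper cmp x∈ y∈) (≤-reflexive (trans (suc-injective ry) (sym rx)))

  meetsEveryRank⇒verticalPair : VerticalPair cs
  meetsEveryRank⇒verticalPair with climb (suc n) ≤-refl
  ... | inj₁ pair         = pair
  ... | inj₂ (x , _ , rx) = contradiction (subst (_≤ n) rx (rank≤length x)) NP.1+n≰n

module _ {n} {cs : List (Vec Bool (suc n))} {u} (cmp : PairwiseComparable cs)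
  (every : MeetsEveryRank (map tail cs)) (u₀ : (false ∷ u) ∈ cs) (u₁ : (true ∷ u) ∈ cs) where

  private
    rankAtMost : ∀ {k} → k ≤ rank u → ∃[ w ] (w ∈ cs × rank w ≡ k)
    rankAtMost k≤ru with every _ (≤-trans k≤ru (rank≤length u))
    ... | x , x∈ , rx with ∈-map⁻ tail x∈
    ...   | false ∷ x , w∈ , refl = false ∷ x , w∈ , rx
    ...   | true ∷ x , w∈ , refl = false ∷ u , u₀ , trans (cong rank u≡x) rx
      where u≡x = ≼∧rank≤⇒≡ (lower≼upper cmp u₀ w∈) (subst (_≤ rank u) (sym rx) k≤ru)

    rankAbove : ∀ {k} → rank u ≤ k → k ≤ n → ∃[ w ] (w ∈ cs × rank w ≡ suc k)
    rankAbove ru≤k k≤n with every _ k≤n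
    ... | x , x∈ , rx with ∈-map⁻ tail x∈
    ...   | true ∷ x , w∈ , refl = true ∷ x , w∈ , cong suc rx
    ...   | false ∷ x , w∈ , refl = true ∷ u , u₁ , cong suc (trans (cong rank (sym x≡u)) rx)
      where x≡u = ≼∧rank≤⇒≡ (lower≼upper cmp w∈ u₁) (subst (rank u ≤_) (sym rx) ru≤k)

  verticalPair⇒meetsEveryRank : MeetsEveryRank cs
  verticalPair⇒meetsEveryRank k _ with k NP.≤? rank u
  ... | yes k≤ru = rankAtMost k≤ru
  verticalPair⇒meetsEveryRank zero    _           | no k≰ru = contradiction z≤n k≰ru
  verticalPair⇒meetsEveryRank (suc k) (s≤s k≤n) | no k≰ru = rankAbove (NP.≤-pred (NP.≰⇒> k≰ru)) k≤n

module _ {n} (D : Doublings n) where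

  meetsEveryRank⇒maximal : ∀ {cs} → IsChain D cs → MeetsEveryRank cs → IsMaximalChain D cs
  meetsEveryRank⇒maximal {cs} chain every = chain , λ z _ z~cs →
    let x , x∈ , rx = every (rank z) (rank≤length z)
    in subst (_∈ cs) (sym (comparable∧rank≡⇒≡ (z~cs x∈) (sym rx))) x∈

  module _ {cs} (chain : IsChain D cs) (every : MeetsEveryRank cs) where

    private
      atRank : Fin (suc n) → Vec Bool n
      atRank k = proj₁ (every (toℕ k) (toℕ≤pred[n] k))

      atRank∈ : ∀ k → atRank k ∈ cs
      atRank∈ k = proj₁ (proj₂ (every (toℕ k) (toℕ≤pred[n] k)))

      rank-atRank : ∀ k → rank (atRank k) ≡ toℕ k
      rank-atRank k = proj₂ (proj₂ (every (toℕ k) (toℕ≤pred[n] k)))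

      rankChain : List (Vec Bool n)
      rankChain = tabulate atRank

      rankChain-chain : IsChain D rankChain
      rankChain-chain = All.tabulate (λ y∈ → All.lookup (proj₁ chain) (rankChain⊆cs y∈)) ,
                        λ y∈ z∈ → proj₂ chain (rankChain⊆cs y∈) (rankChain⊆cs z∈)
        where
        rankChain⊆cs : ∀ {y} → y ∈ rankChain → y ∈ cs
        rankChain⊆cs y∈ with ∈-tabulate⁻ {f = atRank} y∈
        ... | k , refl = atRank∈ k

      rankChain-unique : Unique rankChain
      rankChain-unique = tabulate⁺ {f = atRank} λ {i} {j} e →
        toℕ-injective (trans (sym (rank-atRank i)) (trans (cong rank e) (rank-atRank j)))

      rankChain-maximumLength : IsMaximumLengthChain D rankChain
      rankChain-maximumLength = rankChain-chain , rankChain-unique , λ ds ds-chain ds-unique →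
        subst (length ds ≤_) (sym (length-tabulate atRank))
              (injectiveOn⇒length≤ ds-unique (rankFin-injectiveOn (proj₂ ds-chain)))

    meetsEveryRank⇒inSpine : ∀ {x} → x ∈ cs → InSpine D x
    meetsEveryRank⇒inSpine {x} x∈ =
      rankChain , rankChain-maximumLength , subst (_∈ rankChain) x≡ (∈-tabulate⁺ {f = atRank} (rankFin x))
      where
      x≡ : atRank (rankFin x) ≡ x
      x≡ = comparable∧rank≡⇒≡ (proj₂ chain (atRank∈ _) x∈) (trans (rank-atRank _) (toℕ-rankFin x))

    maximumLength⇒meetsEveryRank : ∀ {ds} → IsMaximumLengthChain D ds → MeetsEveryRank ds
    maximumLength⇒meetsEveryRank {ds} ((_ , cmp) , unique , longest) k k≤n =
      let x , x∈ , rx = injectiveOn∧length≥⇒surjectiveOn unique (rankFin-injectiveOn cmp) 1+n≤length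
                          (fromℕ< (s≤s k≤n))
      in x , x∈ , trans (sym (toℕ-rankFin x)) (trans (cong toℕ rx) (toℕ-fromℕ< (s≤s k≤n)))
      where
      1+n≤length : suc n ≤ length ds
      1+n≤length = subst (_≤ length ds) (length-tabulate atRank)
                         (longest rankChain rankChain-chain rankChain-unique)

-- Lattice operations of a doubling

notBelow : ∀ {n} → Vec Bool n → Vec Bool n → Bool
notBelow b z = not (does (z ≼? b))

hasUpperCopy : ∀ {n} → Vec Bool n → Vec Bool n → Vec Bool n → Bool
hasUpperCopy a b z = notBelow b z ∨ does (a ≼? z)

-- In the doubling of [a,b], (false ∷ z) exists iff z ≼ b, and (true ∷ z) iff z ⋠ b or a ≼ z.
-- A join sits over the join of the tails at the lowest admissible level above both heads,
-- a meet over the meet of the tails at the highest admissible level below both heads.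
join : ∀ {n} (D : Doublings n) → ValidDoublings D → Vec Bool n → Vec Bool n → Vec Bool n
join []      _               []      []      = []
join (D ▷ _) (v , _ , b , _) (i ∷ x) (k ∷ y) = (i ∨ k ∨ notBelow b (join D v x y)) ∷ join D v x y

meet : ∀ {n} (D : Doublings n) → ValidDoublings D → Vec Bool n → Vec Bool n → Vec Bool n
meet []      _               []      []      = []
meet (D ▷ _) (v , a , b , _) (i ∷ x) (k ∷ y) = (i ∧ k ∧ hasUpperCopy a b (meet D v x y)) ∷ meet D v x y

notBelow-false : ∀ {n} {c x : Vec Bool n} → x ≼ c → notBelow c x ≡ false
notBelow-false {c = c} {x} x≼c = cong not (dec-true (x ≼? c) x≼c)

lift : ∀ {n} → Vec Bool n → Vec Bool n → Vec Bool (suc n)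
lift c x = notBelow c x ∷ x

lift-mono : ∀ {n} {c x y : Vec Bool n} → x ≼ y → lift c x ≼ lift c y
lift-mono {c = c} {x} {y} x≼y with x ≼? c | y ≼? c
... | _      | no _    = BP.≤-maximum _ ∷ x≼y
... | yes _  | yes _   = b≤b ∷ x≼y
... | no x⋠c | yes y≼c = contradiction (≼-trans x≼y y≼c) x⋠c

module Doubling {n} (D : Doublings n) (C : Vec Bool n → Set) {a b : Vec Bool n}
  (a∈ : Elem D a) (b∈ : Elem D b) (a≼b : a ≼ b)
  (C⇔ : ∀ x → (C x → Elem D x × a ≼ x × x ≼ b) × (Elem D x × a ≼ x × x ≼ b → C x)) where

  private
    Down⇒≼b : ∀ {x} → Down C x → x ≼ b
    Down⇒≼b (y , Cy , x≼y) = ≼-trans x≼y (proj₂ (proj₂ (proj₁ (C⇔ y) Cy)))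

    ≼b⇒Down : ∀ {x} → x ≼ b → Down C x
    ≼b⇒Down x≼b = b , proj₂ (C⇔ b) (b∈ , a≼b , ≼-refl) , x≼b

  elem-tail : ∀ {w} → Elem (D ▷ C) w → Elem D (tail w)
  elem-tail {false ∷ _} = proj₁
  elem-tail {true  ∷ _} = proj₁

  elem-false : ∀ {x} → Elem D x → x ≼ b → Elem (D ▷ C) (false ∷ x)
  elem-false x∈ x≼b = x∈ , ≼b⇒Down x≼b

  elem-false⇒≼b : ∀ {x} → Elem (D ▷ C) (false ∷ x) → x ≼ b
  elem-false⇒≼b (_ , down) = Down⇒≼b down

  elem-true-⋠ : ∀ {x} → Elem D x → ¬ x ≼ b → Elem (D ▷ C) (true ∷ x)
  elem-true-⋠ x∈ x⋠b = x∈ , inj₁ (x⋠b ∘ Down⇒≼b)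

  elem-true-≽ : ∀ {x} → Elem D x → a ≼ x → Elem (D ▷ C) (true ∷ x)
  elem-true-≽ {x} x∈ a≼x with x ≼? b
  ... | yes x≼b = x∈ , inj₂ (proj₂ (C⇔ x) (x∈ , a≼x , x≼b))
  ... | no  x⋠b = elem-true-⋠ x∈ x⋠b

  elem-true⁻ : ∀ {x} → Elem (D ▷ C) (true ∷ x) → ¬ x ≼ b ⊎ a ≼ x
  elem-true⁻     (_ , inj₁ ¬down) = inj₁ (¬down ∘ ≼b⇒Down)
  elem-true⁻ {x} (_ , inj₂ Cx)    = inj₂ (proj₁ (proj₂ (proj₁ (C⇔ x) Cx)))

  elem-true∧≼b⇒≽a : ∀ {x} → Elem (D ▷ C) (true ∷ x) → x ≼ b → a ≼ x
  elem-true∧≼b⇒≽a x∈ x≼b with elem-true⁻ x∈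
  ... | inj₁ x⋠b = contradiction x≼b x⋠b
  ... | inj₂ a≼x = a≼x

  elem-true-mono : ∀ {x y} → Elem (D ▷ C) (true ∷ x) → Elem D y → x ≼ y → Elem (D ▷ C) (true ∷ y)
  elem-true-mono x∈ y∈ x≼y with elem-true⁻ x∈
  ... | inj₁ x⋠b = elem-true-⋠ y∈ (x⋠b ∘ ≼-trans x≼y)
  ... | inj₂ a≼x = elem-true-≽ y∈ (≼-trans a≼x x≼y)

  verticalPair⇒C : ∀ {u} → Elem (D ▷ C) (false ∷ u) → Elem (D ▷ C) (true ∷ u) → C u
  verticalPair⇒C u₀ u₁ = proj₂ (C⇔ _) (proj₁ u₀ , elem-true∧≼b⇒≽a u₁ u≼b , u≼b)
    where u≼b = elem-false⇒≼b u₀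

  hasUpperCopy-true : ∀ {x} → Elem (D ▷ C) (true ∷ x) → hasUpperCopy a b x ≡ true
  hasUpperCopy-true {x} x∈ with x ≼? b
  ... | yes x≼b = dec-true (a ≼? x) (elem-true∧≼b⇒≽a x∈ x≼b)
  ... | no  _   = refl

  hasUpperCopy-false : ∀ {x} → x ≼ b → ¬ a ≼ x → hasUpperCopy a b x ≡ false
  hasUpperCopy-false {x} x≼b a⋠x = cong₂ _∨_ (notBelow-false x≼b) (dec-false (a ≼? x) a⋠x)

  lift-elem : ∀ {x} → Elem D x → Elem (D ▷ C) (lift b x)
  lift-elem {x} x∈ with x ≼? b
  ... | yes x≼b = elem-false x∈ x≼b
  ... | no  x⋠b = elem-true-⋠ x∈ x⋠b

  join-step : ∀ {i k x y z} → Elem (D ▷ C) (i ∷ x) → Elem (D ▷ C) (k ∷ y) → IsJoin D x y z →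
    IsJoin (D ▷ C) (i ∷ x) (k ∷ y) ((i ∨ k ∨ notBelow b z) ∷ z)
  join-step {true} {k} x∈ _ (z∈ , x≼z , y≼z , least) =
    elem-true-mono x∈ z∈ x≼z , b≤b ∷ x≼z , BP.≤-maximum k ∷ y≼z ,
    λ { (_ ∷ w) w∈ (i≤h ∷ x≼w) (_ ∷ y≼w) → i≤h ∷ least w (elem-tail w∈) x≼w y≼w }
  join-step {false} {true} _ y∈ (z∈ , x≼z , y≼z , least) =
    elem-true-mono y∈ z∈ y≼z , f≤t ∷ x≼z , b≤b ∷ y≼z ,
    λ { (_ ∷ w) w∈ (_ ∷ x≼w) (k≤h ∷ y≼w) → k≤h ∷ least w (elem-tail w∈) x≼w y≼w }
  join-step {false} {false} {z = z} _ _ (z∈ , x≼z , y≼z , least) with z ≼? b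
  ... | yes z≼b = elem-false z∈ z≼b , b≤b ∷ x≼z , b≤b ∷ y≼z ,
    λ { (h ∷ w) w∈ (_ ∷ x≼w) (_ ∷ y≼w) → BP.≤-minimum h ∷ least w (elem-tail w∈) x≼w y≼w }
  ... | no  z⋠b = elem-true-⋠ z∈ z⋠b , f≤t ∷ x≼z , f≤t ∷ y≼z , above
    where
    above : ∀ w → Elem (D ▷ C) w → (false ∷ _) ≼ w → (false ∷ _) ≼ w → (true ∷ z) ≼ w
    above (true  ∷ w) w∈ (_ ∷ x≼w) (_ ∷ y≼w) = b≤b ∷ least w (proj₁ w∈) x≼w y≼w
    above (false ∷ w) w∈ (_ ∷ x≼w) (_ ∷ y≼w) =
      contradiction (≼-trans (least w (proj₁ w∈) x≼w y≼w) (elem-false⇒≼b w∈)) z⋠b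

  meet-step : ∀ {i k x y z} → Elem (D ▷ C) (i ∷ x) → Elem (D ▷ C) (k ∷ y) → IsMeet D x y z →
    IsMeet (D ▷ C) (i ∷ x) (k ∷ y) ((i ∧ k ∧ hasUpperCopy a b z) ∷ z)
  meet-step {false} {k} x∈ _ (z∈ , z≼x , z≼y , greatest) =
    elem-false z∈ (≼-trans z≼x (elem-false⇒≼b x∈)) , b≤b ∷ z≼x , BP.≤-minimum k ∷ z≼y ,
    λ { (_ ∷ w) w∈ (h≤i ∷ w≼x) (_ ∷ w≼y) → h≤i ∷ greatest w (elem-tail w∈) w≼x w≼y }
  meet-step {true} {false} _ y∈ (z∈ , z≼x , z≼y , greatest) =
    elem-false z∈ (≼-trans z≼y (elem-false⇒≼b y∈)) , f≤t ∷ z≼x , b≤b ∷ z≼y ,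
    λ { (_ ∷ w) w∈ (_ ∷ w≼x) (h≤k ∷ w≼y) → h≤k ∷ greatest w (elem-tail w∈) w≼x w≼y }
  meet-step {true} {true} {z = z} _ _ (z∈ , z≼x , z≼y , greatest) with z ≼? b | a ≼? z
  ... | no z⋠b | _ = elem-true-⋠ z∈ z⋠b , b≤b ∷ z≼x , b≤b ∷ z≼y ,
    λ { (h ∷ w) w∈ (_ ∷ w≼x) (_ ∷ w≼y) → BP.≤-maximum h ∷ greatest w (elem-tail w∈) w≼x w≼y }
  ... | yes _ | yes a≼z = elem-true-≽ z∈ a≼z , b≤b ∷ z≼x , b≤b ∷ z≼y ,
    λ { (h ∷ w) w∈ (_ ∷ w≼x) (_ ∷ w≼y) → BP.≤-maximum h ∷ greatest w (elem-tail w∈) w≼x w≼y }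
  ... | yes z≼b | no a⋠z = elem-false z∈ z≼b , f≤t ∷ z≼x , f≤t ∷ z≼y , below
    where
    below : ∀ w → Elem (D ▷ C) w → w ≼ (true ∷ _) → w ≼ (true ∷ _) → w ≼ (false ∷ z)
    below (false ∷ w) w∈ (_ ∷ w≼x) (_ ∷ w≼y) = b≤b ∷ greatest w (proj₁ w∈) w≼x w≼y
    below (true  ∷ w) w∈ (_ ∷ w≼x) (_ ∷ w≼y) =
      contradiction (≼-trans (elem-true∧≼b⇒≽a w∈ (≼-trans w≼z z≼b)) w≼z) a⋠z
      where w≼z = greatest w (proj₁ w∈) w≼x w≼y

  chain-tails : ∀ {cs} → IsChain (D ▷ C) cs → IsChain D (map tail cs)
  chain-tails (all∈ , cmp) = AllP.map⁺ (All.map elem-tail all∈) , tails-comparable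
    where
    tails-comparable : PairwiseComparable (map tail _)
    tails-comparable x∈ y∈ with ∈-map⁻ tail x∈ | ∈-map⁻ tail y∈
    ... | _ ∷ _ , w∈ , refl | _ ∷ _ , w′∈ , refl = comparable-tail (cmp w∈ w′∈)

  module _ {cs} (maximal : IsMaximalChain (D ▷ C) cs) {z} (z~ : ∀ {x} → x ∈ map tail cs → Comparable z x)
    where

    extend-true : Elem (D ▷ C) (true ∷ z) → (∀ {y} → (false ∷ y) ∈ cs → ¬ z ≼ y) → z ∈ map tail cs
    extend-true z∈ not-below = ∈-map⁺ tail (proj₂ maximal (true ∷ z) z∈ z₁~)
      where
      z₁~ : ∀ {w} → w ∈ cs → Comparable (true ∷ z) w
      z₁~ {true ∷ y} w∈ = ∷-comparable (z~ (∈-map⁺ tail w∈))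
      z₁~ {false ∷ y} w∈ with z~ (∈-map⁺ tail w∈)
      ... | inj₁ z≼y = contradiction z≼y (not-below w∈)
      ... | inj₂ y≼z = inj₂ (f≤t ∷ y≼z)

    extend-false : Elem (D ▷ C) (false ∷ z) → (∀ {y} → (true ∷ y) ∈ cs → ¬ y ≼ z) → z ∈ map tail cs
    extend-false z∈ not-above = ∈-map⁺ tail (proj₂ maximal (false ∷ z) z∈ z₀~)
      where
      z₀~ : ∀ {w} → w ∈ cs → Comparable (false ∷ z) w
      z₀~ {false ∷ y} w∈ = ∷-comparable (z~ (∈-map⁺ tail w∈))
      z₀~ {true ∷ y} w∈ with z~ (∈-map⁺ tail w∈)
      ... | inj₁ z≼y = inj₁ (f≤t ∷ z≼y)
      ... | inj₂ y≼z = contradiction y≼z (not-above w∈)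

  -- A missing tail z comparable with all tails would extend the chain at one of its two levels.
  maximalChain-tails : ∀ {cs} → IsMaximalChain (D ▷ C) cs → IsMaximalChain D (map tail cs)
  maximalChain-tails {cs} maximal@((all∈ , cmp) , _) = chain-tails (proj₁ maximal) , tails-maximal
    where
    tails-maximal : ∀ z → Elem D z → (∀ {x} → x ∈ map tail cs → Comparable z x) → z ∈ map tail cs
    tails-maximal z z∈ z~ with any? (≡-dec BP._≟_ z) (map tail cs) | z ≼? b
    ... | yes z∈cs | _       = z∈cs
    ... | no  _    | no  z⋠b = extend-true maximal z~ (elem-true-⋠ z∈ z⋠b)
        λ w∈ z≼y → z⋠b (≼-trans z≼y (elem-false⇒≼b (All.lookup all∈ w∈)))
    ... | no  z∉cs | yes z≼b with a ≼? z
    ...   | no a⋠z = extend-false maximal z~ (elem-false z∈ z≼b)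
        λ w∈ y≼z → a⋠z (≼-trans (elem-true∧≼b⇒≽a (All.lookup all∈ w∈) (≼-trans y≼z z≼b)) y≼z)
    ...   | yes a≼z with any? (λ w → (head w BP.≟ false) ×-dec (z ≼? tail w)) cs
    ...     | no none-above = extend-true maximal z~ (elem-true-≽ z∈ a≼z)
        λ w∈ z≼y → none-above (lose w∈ (refl , z≼y))
    ...     | yes some-above with find some-above
    ...       | false ∷ x , x∈ , refl , z≼x = extend-false maximal z~ (elem-false z∈ z≼b)
        λ y∈ y≼z → z∉cs (subst (_∈ map tail cs) (≼-antisym y≼z (≼-trans z≼x (lower≼upper cmp x∈ y∈)))
                                (∈-map⁺ tail y∈))

  liftChain : ∀ {s cs} → C s → IsChain D cs → s ∈ cs → MeetsEveryRank cs →
    ∃[ cs′ ] (IsChain (D ▷ C) cs′ × MeetsEveryRank cs′)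
  liftChain {s} {cs} Cs (all∈ , cmp) s∈ every =
    cs′ , (elem-true-≽ s∈D a≼s ∷ AllP.map⁺ (All.tabulate lift-elem-s) , cmp′) ,
    verticalPair⇒meetsEveryRank cmp′ every′ s₀∈ (here refl)
    where
    cs′ = (true ∷ s) ∷ map (lift s) cs
    s∈D = All.lookup all∈ s∈
    a≼s = proj₁ (proj₂ (proj₁ (C⇔ s) Cs))
    s≼b = proj₂ (proj₂ (proj₁ (C⇔ s) Cs))

    lift-elem-s : ∀ {x} → x ∈ cs → Elem (D ▷ C) (lift s x)
    lift-elem-s {x} x∈ with x ≼? s | cmp x∈ s∈
    ... | yes x≼s | _        = elem-false (All.lookup all∈ x∈) (≼-trans x≼s s≼b)
    ... | no  x⋠s | inj₁ x≼s = contradiction x≼s x⋠s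
    ... | no  _   | inj₂ s≼x = elem-true-≽ (All.lookup all∈ x∈) (≼-trans a≼s s≼x)

    s₁~lift : ∀ {x} → x ∈ cs → Comparable (true ∷ s) (lift s x)
    s₁~lift {x} x∈ with x ≼? s | cmp x∈ s∈
    ... | yes x≼s | _        = inj₂ (f≤t ∷ x≼s)
    ... | no  x⋠s | inj₁ x≼s = contradiction x≼s x⋠s
    ... | no  _   | inj₂ s≼x = inj₁ (b≤b ∷ s≼x)

    cmp′ : PairwiseComparable cs′
    cmp′ (here refl) (here refl) = inj₁ ≼-refl
    cmp′ (here refl) (there y∈) with ∈-map⁻ (lift s) y∈
    ... | _ , y∈cs , refl = s₁~lift y∈cs
    cmp′ (there x∈) (here refl) with ∈-map⁻ (lift s) x∈
    ... | _ , x∈cs , refl = swap (s₁~lift x∈cs)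
    cmp′ (there x∈) (there y∈) with ∈-map⁻ (lift s) x∈ | ∈-map⁻ (lift s) y∈
    ... | _ , x∈cs , refl | _ , y∈cs , refl = ⊎-map lift-mono lift-mono (cmp x∈cs y∈cs)

    every′ : MeetsEveryRank (map tail cs′)
    every′ = meetsEveryRank-⊆ (λ x∈ → there (∈-map⁺ tail (∈-map⁺ (lift s) x∈))) every

    s₀∈ : (false ∷ s) ∈ cs′
    s₀∈ = there (subst (_∈ map (lift s) cs) (cong (_∷ s) (notBelow-false {c = s} ≼-refl))
                       (∈-map⁺ (lift s) s∈))

join-isJoin : ∀ {n} (D : Doublings n) (v : ValidDoublings D) {x y} → Elem D x → Elem D y →
  IsJoin D x y (join D v x y)
join-isJoin []      _                                {[]}    {[]}    _  _  =
  tt , [] , [] , λ { [] _ _ _ → [] }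
join-isJoin (D ▷ C) (v , _ , _ , a∈ , b∈ , a≼b , C⇔) {_ ∷ _} {_ ∷ _} x∈ y∈ =
  join-step x∈ y∈ (join-isJoin D v (elem-tail x∈) (elem-tail y∈))
  where open Doubling D C a∈ b∈ a≼b C⇔

meet-isMeet : ∀ {n} (D : Doublings n) (v : ValidDoublings D) {x y} → Elem D x → Elem D y →
  IsMeet D x y (meet D v x y)
meet-isMeet []      _                                {[]}    {[]}    _  _  =
  tt , [] , [] , λ { [] _ _ _ → [] }
meet-isMeet (D ▷ C) (v , _ , _ , a∈ , b∈ , a≼b , C⇔) {_ ∷ _} {_ ∷ _} x∈ y∈ =
  meet-step x∈ y∈ (meet-isMeet D v (elem-tail x∈) (elem-tail y∈))
  where open Doubling D C a∈ b∈ a≼b C⇔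

isJoin-unique : ∀ {n} (D : Doublings n) {x y j j′} → IsJoin D x y j → IsJoin D x y j′ → j ≡ j′
isJoin-unique _ (j∈ , x≼j , y≼j , j-least) (j′∈ , x≼j′ , y≼j′ , j′-least) =
  ≼-antisym (j-least _ j′∈ x≼j′ y≼j′) (j′-least _ j∈ x≼j y≼j)

isMeet-unique : ∀ {n} (D : Doublings n) {x y m m′} → IsMeet D x y m → IsMeet D x y m′ → m ≡ m′
isMeet-unique _ (m∈ , m≼x , m≼y , m-greatest) (m′∈ , m′≼x , m′≼y , m′-greatest) =
  ≼-antisym (m′-greatest _ m∈ m≼x m≼y) (m-greatest _ m′∈ m′≼x m′≼y)

module Lattice {n} (D : Doublings n) (v : ValidDoublings D) where

  infixr 26 _⊔_
  infixr 27 _⊓_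

  _⊔_ : Vec Bool n → Vec Bool n → Vec Bool n
  _⊔_ = join D v

  _⊓_ : Vec Bool n → Vec Bool n → Vec Bool n
  _⊓_ = meet D v

  module _ {x y} (x∈ : Elem D x) (y∈ : Elem D y) where

    ⊔-elem : Elem D (x ⊔ y)
    ⊔-elem = proj₁ (join-isJoin D v x∈ y∈)

    x≼x⊔y : x ≼ x ⊔ y
    x≼x⊔y = proj₁ (proj₂ (join-isJoin D v x∈ y∈))

    y≼x⊔y : y ≼ x ⊔ y
    y≼x⊔y = proj₁ (proj₂ (proj₂ (join-isJoin D v x∈ y∈)))

    ⊔-least : ∀ {z} → Elem D z → x ≼ z → y ≼ z → x ⊔ y ≼ z
    ⊔-least = proj₂ (proj₂ (proj₂ (join-isJoin D v x∈ y∈))) _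

    ⊓-elem : Elem D (x ⊓ y)
    ⊓-elem = proj₁ (meet-isMeet D v x∈ y∈)

    x⊓y≼x : x ⊓ y ≼ x
    x⊓y≼x = proj₁ (proj₂ (meet-isMeet D v x∈ y∈))

    x⊓y≼y : x ⊓ y ≼ y
    x⊓y≼y = proj₁ (proj₂ (proj₂ (meet-isMeet D v x∈ y∈)))

    ⊓-greatest : ∀ {z} → Elem D z → z ≼ x → z ≼ y → z ≼ x ⊓ y
    ⊓-greatest = proj₂ (proj₂ (proj₂ (meet-isMeet D v x∈ y∈))) _

    isJoin⇒≡⊔ : ∀ {j} → IsJoin D x y j → j ≡ x ⊔ y
    isJoin⇒≡⊔ j-join = isJoin-unique D j-join (join-isJoin D v x∈ y∈)

    isMeet⇒≡⊓ : ∀ {m} → IsMeet D x y m → m ≡ x ⊓ y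
    isMeet⇒≡⊓ m-meet = isMeet-unique D m-meet (meet-isMeet D v x∈ y∈)

    y≼x⇒x⊔y≡x : y ≼ x → x ⊔ y ≡ x
    y≼x⇒x⊔y≡x y≼x = sym (isJoin⇒≡⊔ (x∈ , ≼-refl , y≼x , λ _ _ x≼z _ → x≼z))

    y≼x⇒x⊓y≡y : y ≼ x → x ⊓ y ≡ y
    y≼x⇒x⊓y≡y y≼x = sym (isMeet⇒≡⊓ (y∈ , y≼x , ≼-refl , λ _ _ _ z≼y → z≼y))

  LeftModularEq : Vec Bool n → Set
  LeftModularEq u = ∀ {p q} → Elem D p → Elem D q → p ≺ q → (p ⊔ u) ⊓ q ≡ p ⊔ (u ⊓ q)

  module _ {u} (u∈ : Elem D u) where

    leftModular⇒Eq : LeftModularElem D u → LeftModularEq u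
    leftModular⇒Eq lm p∈ q∈ p≺q =
      lm _ _ p∈ q∈ p≺q _ _ _ _ (join-isJoin D v p∈ u∈) (meet-isMeet D v (⊔-elem p∈ u∈) q∈)
         (meet-isMeet D v u∈ q∈) (join-isJoin D v p∈ (⊓-elem u∈ q∈))

    Eq⇒leftModular : LeftModularEq u → LeftModularElem D u
    Eq⇒leftModular eq p q p∈ q∈ p≺q j m m′ j′ j-join m-meet m′-meet j′-join = begin
      m                ≡⟨ isMeet⇒≡⊓ (proj₁ j-join) q∈ m-meet ⟩
      j ⊓ q            ≡⟨ cong (_⊓ q) (isJoin⇒≡⊔ p∈ u∈ j-join) ⟩
      (p ⊔ u) ⊓ q      ≡⟨ eq p∈ q∈ p≺q ⟩
      p ⊔ (u ⊓ q)      ≡⟨ cong (p ⊔_) (isMeet⇒≡⊓ u∈ q∈ m′-meet) ⟨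
      p ⊔ m′           ≡⟨ isJoin⇒≡⊔ p∈ (proj₁ m′-meet) j′-join ⟨
      j′               ∎
      where open ≡-Reasoning

    -- For p = q both sides collapse to p.
    leftModularEq-≼ : LeftModularEq u → ∀ {p q} → Elem D p → Elem D q → p ≼ q →
      (p ⊔ u) ⊓ q ≡ p ⊔ (u ⊓ q)
    leftModularEq-≼ eq {p} {q} p∈ q∈ p≼q with ≡-dec BP._≟_ p q
    ... | no  p≢q  = eq p∈ q∈ (p≼q , p≢q)
    ... | yes refl = trans (y≼x⇒x⊓y≡y (⊔-elem p∈ u∈) p∈ (x≼x⊔y p∈ u∈))
                           (sym (y≼x⇒x⊔y≡x p∈ (⊓-elem u∈ p∈) (x⊓y≼y u∈ p∈)))

-- Left modularity under doubling

module DoublingLattice {n} (D : Doublings n) (C : Vec Bool n → Set) (v : ValidDoublings D)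
  {a b : Vec Bool n} (a∈ : Elem D a) (b∈ : Elem D b) (a≼b : a ≼ b)
  (C⇔ : ∀ x → (C x → Elem D x × a ≼ x × x ≼ b) × (Elem D x × a ≼ x × x ≼ b → C x)) where

  open Doubling D C a∈ b∈ a≼b C⇔ public
  open Lattice D v

  V : ValidDoublings (D ▷ C)
  V = v , a , b , a∈ , b∈ , a≼b , C⇔

  module L′ = Lattice (D ▷ C) V

  private
    hasUpperCopy-⊔⊓ : ∀ {p q u} → Elem (D ▷ C) (true ∷ p) → Elem D q → Elem D u → p ≼ q →
      hasUpperCopy a b ((p ⊔ u) ⊓ q) ≡ true
    hasUpperCopy-⊔⊓ p∈ q∈ u∈ p≼q = hasUpperCopy-true (elem-true-mono p∈ (⊓-elem p⊔u∈ q∈)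
      (⊓-greatest p⊔u∈ q∈ (proj₁ p∈) (x≼x⊔y (proj₁ p∈) u∈) p≼q))
      where p⊔u∈ = ⊔-elem (proj₁ p∈) u∈

    hasUpperCopy-≡ : ∀ {m t} → m ≼ t → (a ≼ t → a ≼ m) →
      hasUpperCopy a b t ≡ hasUpperCopy a b m ∨ notBelow b t
    hasUpperCopy-≡ {m} {t} m≼t a≼t⇒a≼m with t ≼? b
    ... | no  _   = sym (BP.∨-zeroʳ _)
    ... | yes t≼b = begin
      does (a ≼? t)                           ≡⟨ does-agree ⟩
      does (a ≼? m)                           ≡⟨ cong (_∨ does (a ≼? m)) m-notBelow ⟨
      notBelow b m ∨ does (a ≼? m)           ≡⟨ BP.∨-identityʳ _ ⟨
      (notBelow b m ∨ does (a ≼? m)) ∨ false ∎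
      where
      open ≡-Reasoning
      m-notBelow = notBelow-false (≼-trans m≼t t≼b)
      does-agree : does (a ≼? t) ≡ does (a ≼? m)
      does-agree with a ≼? t
      ... | yes a≼t = sym (dec-true (a ≼? m) (a≼t⇒a≼m a≼t))
      ... | no  a⋠t = sym (dec-false (a ≼? m) (a⋠t ∘ λ a≼m → ≼-trans a≼m m≼t))

  leftModularEq-false : ∀ {u} → Elem D u → u ≼ b → LeftModularEq u → L′.LeftModularEq (false ∷ u)
  leftModularEq-false {u} u∈ u≼b eq {i ∷ p} {j ∷ q} p∈ q∈ (i≤j ∷ p≼q , _) =
    cong₂ _∷_ (head-eq i≤j p∈ q∈) (leftModularEq-≼ u∈ eq (elem-tail p∈) (elem-tail q∈) p≼q)
    where
    head-eq : ∀ {i j} → i B.≤ j → Elem (D ▷ C) (i ∷ p) → Elem (D ▷ C) (j ∷ q) →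
      (i ∨ notBelow b (p ⊔ u)) ∧ j ∧ hasUpperCopy a b ((p ⊔ u) ⊓ q) ≡ i ∨ notBelow b (p ⊔ (u ⊓ q))
    head-eq {true}  b≤b p∈ q∈ = hasUpperCopy-⊔⊓ p∈ (proj₁ q∈) u∈ p≼q
    head-eq {false} {j} _ p∈ q∈ = begin
      notBelow b (p ⊔ u) ∧ rest  ≡⟨ cong (_∧ rest) (notBelow-false (⊔-least p∈′ u∈ b∈ p≼b u≼b)) ⟩
      false                      ≡⟨ notBelow-false (⊔-least p∈′ u⊓q∈ b∈ p≼b (≼-trans (x⊓y≼x u∈ q∈′) u≼b)) ⟨
      notBelow b (p ⊔ (u ⊓ q))   ∎
      where
      open ≡-Reasoning
      rest = j ∧ hasUpperCopy a b ((p ⊔ u) ⊓ q)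
      p∈′ = proj₁ p∈
      q∈′ = elem-tail q∈
      u⊓q∈ = ⊓-elem u∈ q∈′
      p≼b = elem-false⇒≼b p∈

  leftModularEq-true : ∀ {u} → Elem D u → a ≼ u → LeftModularEq u → L′.LeftModularEq (true ∷ u)
  leftModularEq-true {u} u∈ a≼u eq {i ∷ p} {j ∷ q} p∈ q∈ (i≤j ∷ p≼q , _) =
    cong₂ _∷_ (head-eq i≤j p∈ q∈) tail-eq
    where
    p∈′ = elem-tail p∈
    q∈′ = elem-tail q∈
    u⊓q∈ = ⊓-elem u∈ q∈′
    p⊔u∈ = ⊔-elem p∈′ u∈
    tail-eq : (p ⊔ u) ⊓ q ≡ p ⊔ (u ⊓ q)
    tail-eq = leftModularEq-≼ u∈ eq p∈′ q∈′ p≼q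
    head-eq : ∀ {i j} → i B.≤ j → Elem (D ▷ C) (i ∷ p) → Elem (D ▷ C) (j ∷ q) →
      (i ∨ true ∨ notBelow b (p ⊔ u)) ∧ j ∧ hasUpperCopy a b ((p ⊔ u) ⊓ q)
        ≡ i ∨ (j ∧ hasUpperCopy a b (u ⊓ q)) ∨ notBelow b (p ⊔ (u ⊓ q))
    head-eq {true}          b≤b p∈ q∈ = hasUpperCopy-⊔⊓ p∈ q∈′ u∈ p≼q
    head-eq {false} {false} _   _  q∈ =
      sym (notBelow-false (⊔-least p∈′ u⊓q∈ b∈ (≼-trans p≼q q≼b) (≼-trans (x⊓y≼y u∈ q∈′) q≼b)))
      where q≼b = elem-false⇒≼b q∈
    head-eq {false} {true}  _   _  _  = begin
      hasUpperCopy a b ((p ⊔ u) ⊓ q)                       ≡⟨ hasUpperCopy-≡ u⊓q≼t a≼t⇒a≼u⊓q ⟩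
      hasUpperCopy a b (u ⊓ q) ∨ notBelow b ((p ⊔ u) ⊓ q)  ≡⟨ cong (λ t → _ ∨ notBelow b t) tail-eq ⟩
      hasUpperCopy a b (u ⊓ q) ∨ notBelow b (p ⊔ (u ⊓ q))  ∎
      where
      open ≡-Reasoning
      u⊓q≼t : u ⊓ q ≼ (p ⊔ u) ⊓ q
      u⊓q≼t = ⊓-greatest p⊔u∈ q∈′ u⊓q∈ (≼-trans (x⊓y≼x u∈ q∈′) (y≼x⊔y p∈′ u∈)) (x⊓y≼y u∈ q∈′)
      a≼t⇒a≼u⊓q : a ≼ (p ⊔ u) ⊓ q → a ≼ u ⊓ q
      a≼t⇒a≼u⊓q a≼t = ⊓-greatest u∈ q∈′ a∈ a≼u (≼-trans a≼t (x⊓y≼y p⊔u∈ q∈′))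

  leftModularEq-tail : ∀ {h u} → L′.LeftModularEq (h ∷ u) → LeftModularEq u
  leftModularEq-tail eq p∈ q∈ (p≼q , p≢q) =
    cong tail (eq (lift-elem p∈) (lift-elem q∈) (lift-mono p≼q , p≢q ∘ cong tail))

  -- Left modularity fails at the pair false ∷ a ≺ true ∷ a unless a ≼ u.
  leftModularEq-true⇒≽a : ∀ {u} → Elem D u → L′.LeftModularEq (true ∷ u) → a ≼ u
  leftModularEq-true⇒≽a {u} u∈ eq with a ≼? u
  ... | yes a≼u = a≼u
  ... | no  a⋠u = contradiction (trans (sym lhs-head) (trans (cong head modular) rhs-head)) λ ()
    where
    modular = eq (elem-false a∈ a≼b) (elem-true-≽ a∈ ≼-refl) (f≤t ∷ ≼-refl , λ ())
    a⊔u∈ = ⊔-elem a∈ u∈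
    u⊓a∈ = ⊓-elem u∈ a∈
    u⊓a≼b = ≼-trans (x⊓y≼y u∈ a∈) a≼b
    lhs-head : hasUpperCopy a b ((a ⊔ u) ⊓ a) ≡ true
    lhs-head = hasUpperCopy-true
      (elem-true-≽ (⊓-elem a⊔u∈ a∈) (⊓-greatest a⊔u∈ a∈ a∈ (x≼x⊔y a∈ u∈) ≼-refl))
    rhs-head : hasUpperCopy a b (u ⊓ a) ∨ notBelow b (a ⊔ (u ⊓ a)) ≡ false
    rhs-head = cong₂ _∨_ (hasUpperCopy-false u⊓a≼b (a⋠u ∘ λ a≼u⊓a → ≼-trans a≼u⊓a (x⊓y≼x u∈ a∈)))
                         (notBelow-false (⊔-least a∈ u⊓a∈ b∈ a≼b u⊓a≼b))

  module _ {u} (u∈ : Elem D u) where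

    leftModular-false : u ≼ b → LeftModularElem D u → LeftModularElem (D ▷ C) (false ∷ u)
    leftModular-false u≼b lm =
      L′.Eq⇒leftModular (elem-false u∈ u≼b) (leftModularEq-false u∈ u≼b (leftModular⇒Eq u∈ lm))

    leftModular-true : a ≼ u → LeftModularElem D u → LeftModularElem (D ▷ C) (true ∷ u)
    leftModular-true a≼u lm =
      L′.Eq⇒leftModular (elem-true-≽ u∈ a≼u) (leftModularEq-true u∈ a≼u (leftModular⇒Eq u∈ lm))

  leftModular-tail : ∀ {w} → Elem (D ▷ C) w → LeftModularElem (D ▷ C) w → LeftModularElem D (tail w)
  leftModular-tail {_ ∷ _} w∈ lm =
    Eq⇒leftModular (elem-tail w∈) (leftModularEq-tail (L′.leftModular⇒Eq w∈ lm))

  leftModular-true⇒≽a : ∀ {u} → Elem (D ▷ C) (true ∷ u) → LeftModularElem (D ▷ C) (true ∷ u) → a ≼ u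
  leftModular-true⇒≽a u∈ lm = leftModularEq-true⇒≽a (proj₁ u∈) (L′.leftModular⇒Eq u∈ lm)

  -- Take the least upper element true ∷ y.  If y ≼ b then false ∷ y fits into the chain;
  -- otherwise true ∷ (y ⊓ b) would fit in strictly below it.
  maximal⇒verticalPair : ∀ {cs} → IsMaximalChain (D ▷ C) cs → (∀ {y} → (true ∷ y) ∈ cs → a ≼ y) →
    VerticalPair cs
  maximal⇒verticalPair {cs} ((all∈ , cmp) , maximal) upper≽a
    with least-satisfying ≼-refl ≼-trans (λ w → head w BP.≟ true) cs cmp
  ... | inj₁ no-upper =
    contradiction refl (All.lookup no-upper (maximal (true ∷ b) (elem-true-≽ b∈ a≼b) b₁~))
    where
    b₁~ : ∀ {w} → w ∈ cs → Comparable (true ∷ b) w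
    b₁~ {false ∷ _} w∈ = inj₂ (f≤t ∷ elem-false⇒≼b (All.lookup all∈ w∈))
    b₁~ {true  ∷ _} w∈ = contradiction refl (All.lookup no-upper w∈)
  ... | inj₂ (true ∷ y , y∈ , refl , y-least) with y ≼? b
  ...   | yes y≼b = y , maximal (false ∷ y) (elem-false y∈D y≼b) y₀~ , y∈
    where
    y∈D = proj₁ (All.lookup all∈ y∈)
    y₀~ : ∀ {w} → w ∈ cs → Comparable (false ∷ y) w
    y₀~ {false ∷ _} w∈ = inj₂ (b≤b ∷ lower≼upper cmp w∈ y∈)
    y₀~ {true  ∷ _} w∈ = inj₁ (f≤t ∷ ≼-tail (y-least w∈ refl))
  ...   | no  y⋠b = contradiction (≼-trans (≼-tail (y-least m₁∈ refl)) (x⊓y≼y y∈D b∈)) y⋠b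
    where
    y∈D = proj₁ (All.lookup all∈ y∈)
    m₁∈ : (true ∷ (y ⊓ b)) ∈ cs
    m₁∈ = maximal (true ∷ (y ⊓ b))
            (elem-true-≽ (⊓-elem y∈D b∈) (⊓-greatest y∈D b∈ a∈ (upper≽a y∈) a≼b)) m₁~
      where
      m₁~ : ∀ {w} → w ∈ cs → Comparable (true ∷ (y ⊓ b)) w
      m₁~ {false ∷ _} w∈ =
        inj₂ (f≤t ∷ ⊓-greatest y∈D b∈ (proj₁ x∈) (lower≼upper cmp w∈ y∈) (elem-false⇒≼b x∈))
        where x∈ = All.lookup all∈ w∈
      m₁~ {true  ∷ _} w∈ = inj₁ (b≤b ∷ ≼-trans (x⊓y≼x y∈D b∈) (≼-tail (y-least w∈ refl)))

  module _ {cs} (chain : IsMaximalChain (D ▷ C) cs) (lms : All (LeftModularElem (D ▷ C)) cs) where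

    leftModularMaximalChain-tails : IsMaximalChain D (map tail cs) × All (LeftModularElem D) (map tail cs)
    leftModularMaximalChain-tails = maximalChain-tails chain ,
      AllP.map⁺ (All.zipWith (λ (w∈ , lm) → leftModular-tail w∈ lm) (proj₁ (proj₁ chain) , lms))

    leftModularMaximalChain⇒verticalPair : VerticalPair cs
    leftModularMaximalChain⇒verticalPair = maximal⇒verticalPair chain λ y∈ →
      leftModular-true⇒≽a (All.lookup (proj₁ (proj₁ chain)) y∈) (All.lookup lms y∈)

  tails-leftModular⇒leftModular : ∀ {cs} → IsChain (D ▷ C) cs → MeetsEveryRank cs →
    All (LeftModularElem D) (map tail cs) → All (LeftModularElem (D ▷ C)) cs
  tails-leftModular⇒leftModular {cs} (all∈ , cmp) every tails-lm = All.tabulate lm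
    where
    pair = meetsEveryRank⇒verticalPair cmp every
    u₀∈ = proj₁ (proj₂ pair)
    a≼u = elem-true∧≼b⇒≽a (All.lookup all∈ (proj₂ (proj₂ pair))) (elem-false⇒≼b (All.lookup all∈ u₀∈))
    lm : ∀ {w} → w ∈ cs → LeftModularElem (D ▷ C) w
    lm {false ∷ _} w∈ = leftModular-false (proj₁ x∈) (elem-false⇒≼b x∈) (All.lookup tails-lm (∈-map⁺ tail w∈))
      where x∈ = All.lookup all∈ w∈
    lm {true  ∷ _} w∈ = leftModular-true (proj₁ (All.lookup all∈ w∈)) (≼-trans a≼u (lower≼upper cmp u₀∈ w∈))
                          (All.lookup tails-lm (∈-map⁺ tail w∈))

-- Induction on the number of doublings

leftModularMaximalChain⇒meetsEveryRank : ∀ {n} (D : Doublings n) → ValidDoublings D → ∀ {cs} →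
  IsMaximalChain D cs → All (LeftModularElem D) cs → MeetsEveryRank cs
leftModularMaximalChain⇒meetsEveryRank [] _ (_ , maximal) _ zero z≤n =
  [] , maximal [] tt (λ { {[]} _ → inj₁ [] }) , refl
leftModularMaximalChain⇒meetsEveryRank (D ▷ C) (v , _ , _ , a∈ , b∈ , a≼b , C⇔) chain lms =
  let tails-maximal , tails-lm = leftModularMaximalChain-tails chain lms
      _ , u₀∈ , u₁∈ = leftModularMaximalChain⇒verticalPair chain lms
  in verticalPair⇒meetsEveryRank (proj₂ (proj₁ chain))
       (leftModularMaximalChain⇒meetsEveryRank D v tails-maximal tails-lm) u₀∈ u₁∈
  where open DoublingLattice D C v a∈ b∈ a≼b C⇔

meetsEveryRank⇒leftModular : ∀ {n} (D : Doublings n) → ValidDoublings D → ∀ {cs} →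
  IsChain D cs → MeetsEveryRank cs → All (LeftModularElem D) cs
meetsEveryRank⇒leftModular []      _ _ _ =
  All.tabulate λ { {[]} _ [] [] _ _ (_ , []≢[]) → contradiction refl []≢[] }
meetsEveryRank⇒leftModular (D ▷ C) (v , _ , _ , a∈ , b∈ , a≼b , C⇔) chain every =
  tails-leftModular⇒leftModular chain every
    (meetsEveryRank⇒leftModular D v (chain-tails chain) (meetsEveryRank-tails (proj₂ chain) every))
  where open DoublingLattice D C v a∈ b∈ a≼b C⇔

leftModular⇒allMeetSpine : ∀ {n} (D : Doublings n) → ValidDoublings D →
  IsLeftModularLattice D → AllMeetSpine D
leftModular⇒allMeetSpine []      _ _ = tt
leftModular⇒allMeetSpine (D ▷ C) (v , _ , _ , a∈ , b∈ , a≼b , C⇔) (cs , chain , lms) =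
  let tails-maximal , tails-lm = leftModularMaximalChain-tails chain lms
      u , u₀∈ , u₁∈ = leftModularMaximalChain⇒verticalPair chain lms
      all∈ = proj₁ (proj₁ chain)
  in leftModular⇒allMeetSpine D v (map tail cs , tails-maximal , tails-lm) ,
     u , verticalPair⇒C (All.lookup all∈ u₀∈) (All.lookup all∈ u₁∈) ,
     meetsEveryRank⇒inSpine D (proj₁ tails-maximal)
       (leftModularMaximalChain⇒meetsEveryRank D v tails-maximal tails-lm) (∈-map⁺ tail u₀∈)
  where open DoublingLattice D C v a∈ b∈ a≼b C⇔

allMeetSpine⇒chainMeetingEveryRank : ∀ {n} (D : Doublings n) → ValidDoublings D → AllMeetSpine D →
  ∃[ cs ] (IsChain D cs × MeetsEveryRank cs)
allMeetSpine⇒chainMeetingEveryRank [] _ _ =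
  [] ∷ [] , (tt ∷ [] , λ { (here refl) (here refl) → inj₁ [] }) , λ { zero z≤n → [] , here refl , refl }
allMeetSpine⇒chainMeetingEveryRank (D ▷ C) (v , _ , _ , a∈ , b∈ , a≼b , C⇔)
                                   (spines , _ , Cs , _ , maxLength , s∈) =
  let _ , fs-chain , fs-every = allMeetSpine⇒chainMeetingEveryRank D v spines
  in liftChain Cs (proj₁ maxLength) s∈ (maximumLength⇒meetsEveryRank D fs-chain fs-every maxLength)
  where open Doubling D C a∈ b∈ a≼b C⇔

corollary3p21 : (n : ℕ) (D : Doublings n) → ValidDoublings D →
    (IsLeftModularLattice D ⇔ AllMeetSpine D)
corollary3p21 n D v = mk⇔ (leftModular⇒allMeetSpine D v) λ spines →
  let cs , chain , every = allMeetSpine⇒chainMeetingEveryRank D v spines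
  in cs , meetsEveryRank⇒maximal D chain every , meetsEveryRank⇒leftModular D v chain every
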